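{- Suppose that $u \geq 2$, $s$, $t$ are integers, $n=3^u$, $1 \leq s,t \leq n/2$, $3 \mid s$, and $3 \nmid t$. Then $\chi(C_n, \{s,t\})=3$.
   Context: $C_n$ is the cycle with vertex set $\mathbb{Z}_n=\{0,1,\dots,n-1\}$, $i$ adjacent to $i\pm1 \pmod n$; the graph distance is $\mathrm{dist}(i,j)=\min(|i-j|,\,n-|i-j|)$. For a set $D$ of positive integers, the distance graph $G(C_n,D)$ has vertex set $\mathbb{Z}_n$, with distinct $i,j$ adjacent iff $\mathrm{dist}(i,j)\in D$; $\chi(C_n,D)$ is its chromatic number. -}

module Defs where

open import Data.Nat using (ℕ; _∸_; _≤_; _⊓_; ∣_-_∣)
open import Data.Fin using (Fin; toℕ)
open import Data.Product using (_×_)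
import Data.Product
import Data.Sum
open import Relation.Binary.PropositionalEquality using (_≡_)
open import Relation.Nullary using (¬_)

cdist : (n : ℕ) → Fin n → Fin n → ℕ
cdist n i j = ∣ toℕ i - toℕ j ∣ ⊓ (n ∸ ∣ toℕ i - toℕ j ∣)

Adj : (n : ℕ) → (D : ℕ → Set) → Fin n → Fin n → Set
Adj n D i j = ¬ (i ≡ j) × D (cdist n i j)

ProperColouring : (n : ℕ) → (D : ℕ → Set) → (k : ℕ) → (Fin n → Fin k) → Set
ProperColouring n D k c = ∀ i j → Adj n D i j → ¬ (c i ≡ c j)

Colourable : (n : ℕ) → (D : ℕ → Set) → (k : ℕ) → Set
Colourable n D k = Data.Product.Σ (Fin n → Fin k) (ProperColouring n D k)

ChromaticNumberIs : (n : ℕ) → (D : ℕ → Set) → (k : ℕ) → Set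
ChromaticNumberIs n D k = Colourable n D k × (∀ m → Colourable n D m → k ≤ m)

Pair : ℕ → ℕ → ℕ → Set
Pair s t d = (d ≡ s) Data.Sum.⊎ (d ≡ t)

-- Lower bound: for 0 < t ≤ n/2 the vertices 0, t, 2t, … (mod n) form a closed walk of odd length n
-- along edges of distance t, so two colours never suffice.
-- Upper bound: write s = s′·B with B = 3^a, a ≥ 1, 3 ∤ s′, and colour x by e·x + ⌊x/B⌋ mod 3.
-- Shifting x by n or by s changes this by e·n + n/B ≡ 0 resp. e·s′·B + s′ ≡ s′ ≢ 0 (mod 3), so the
-- colouring is well defined on ℤ_n and proper for distance s; shifting by t changes it by
-- e·t + ⌊t/B⌋ + c with a carry c ∈ {0, 1}, and since 3 ∤ t we may choose e with e·t + ⌊t/B⌋ ≡ 1.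
module Submission where

open import Defs
open import Data.Nat
open import Data.Nat.Properties
open import Data.Nat.DivMod
open import Data.Nat.Divisibility
open import Data.Nat.Induction using (<-rec)
open import Data.Nat.Tactic.RingSolver using (solve-∀)
open import Data.Fin using (Fin; toℕ; inject≤)
import Data.Fin as Fin
open import Data.Fin.Properties using (toℕ-fromℕ<; toℕ-injective; toℕ<n; inject≤-injective)
open import Data.Product using (∃; ∃₂; _×_; _,_)
open import Data.Sum using (_⊎_; inj₁; inj₂; swap)
open import Function using (_∘_)
open import Relation.Nullary using (¬_; yes; no; contradiction)
open import Relation.Binary.PropositionalEquality

cycleDist : ℕ → ℕ → ℕ → ℕ
cycleDist n x y = ∣ x - y ∣ ⊓ (n ∸ ∣ x - y ∣)

-- For x, y < n and d ≤ n: y ≡ x + d modulo n.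
Clockwise : ℕ → ℕ → ℕ → ℕ → Set
Clockwise n d x y = y ≡ x + d ⊎ y + n ≡ x + d

cycleDist-comm : ∀ n x y → cycleDist n x y ≡ cycleDist n y x
cycleDist-comm n x y rewrite ∣-∣-comm x y = refl

cycleDist-+ : ∀ n x δ → cycleDist n x (x + δ) ≡ δ ⊓ (n ∸ δ)
cycleDist-+ n x δ rewrite ∣m-m+n∣≡n x δ = refl

clockwise⇒cycleDist : ∀ {n d x y} → d + d ≤ n → Clockwise n d x y → cycleDist n x y ≡ d
clockwise⇒cycleDist {n} {d} {x} d+d≤n (inj₁ refl) =
  trans (cycleDist-+ n x d) (m≤n⇒m⊓n≡m (m+n≤o⇒m≤o∸n d d+d≤n))
clockwise⇒cycleDist {n} {d} {x} {y} d+d≤n (inj₂ y+n≡x+d) = begin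
  cycleDist n x y                   ≡⟨ cong (λ z → cycleDist n z y) x≡y+[n∸d] ⟩
  cycleDist n (y + (n ∸ d)) y       ≡⟨ cycleDist-comm n (y + (n ∸ d)) y ⟩
  cycleDist n y (y + (n ∸ d))       ≡⟨ cycleDist-+ n y (n ∸ d) ⟩
  (n ∸ d) ⊓ (n ∸ (n ∸ d))           ≡⟨ cong ((n ∸ d) ⊓_) (m∸[m∸n]≡n d≤n) ⟩
  (n ∸ d) ⊓ d                       ≡⟨ m≥n⇒m⊓n≡n (m+n≤o⇒m≤o∸n d d+d≤n) ⟩
  d                                 ∎
  where
  open ≡-Reasoning
  d≤n : d ≤ n
  d≤n = m+n≤o⇒m≤o d d+d≤n
  x≡y+[n∸d] : x ≡ y + (n ∸ d)
  x≡y+[n∸d] = +-cancelʳ-≡ d x (y + (n ∸ d)) (begin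
    x + d             ≡⟨ sym y+n≡x+d ⟩
    y + n             ≡⟨ cong (y +_) (sym (m∸n+n≡m d≤n)) ⟩
    y + (n ∸ d + d)   ≡⟨ sym (+-assoc y (n ∸ d) d) ⟩
    y + (n ∸ d) + d   ∎)

gap⇒clockwise : ∀ {n d} x δ → δ ≤ n → δ ⊓ (n ∸ δ) ≡ d →
                Clockwise n d x (x + δ) ⊎ Clockwise n d (x + δ) x
gap⇒clockwise {n} x δ δ≤n refl with ≤-total δ (n ∸ δ)
... | inj₁ δ≤n∸δ = inj₁ (inj₁ (cong (x +_) (sym (m≤n⇒m⊓n≡m δ≤n∸δ))))
... | inj₂ n∸δ≤δ = inj₂ (inj₂ (begin
  x + n                   ≡⟨ cong (x +_) (sym (m+[n∸m]≡n δ≤n)) ⟩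
  x + (δ + (n ∸ δ))       ≡⟨ sym (+-assoc x δ (n ∸ δ)) ⟩
  x + δ + (n ∸ δ)         ≡⟨ cong (x + δ +_) (sym (m≥n⇒m⊓n≡n n∸δ≤δ)) ⟩
  x + δ + δ ⊓ (n ∸ δ)     ∎))
  where open ≡-Reasoning

cycleDist⇒clockwise-≤ : ∀ {n d x y} → x ≤ y → y < n → cycleDist n x y ≡ d →
                        Clockwise n d x y ⊎ Clockwise n d y x
cycleDist⇒clockwise-≤ {n} {x = x} x≤y y<n dist≡d with m≤n⇒∃[o]m+o≡n x≤y
... | δ , refl = gap⇒clockwise x δ (≤-trans (m≤n+m δ x) (<⇒≤ y<n)) (trans (sym (cycleDist-+ n x δ)) dist≡d)

cycleDist⇒clockwise : ∀ {n d x y} → x < n → y < n → cycleDist n x y ≡ d →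
                      Clockwise n d x y ⊎ Clockwise n d y x
cycleDist⇒clockwise {n} {x = x} {y} x<n y<n dist≡d with ≤-total x y
... | inj₁ x≤y = cycleDist⇒clockwise-≤ x≤y y<n dist≡d
... | inj₂ y≤x = swap (cycleDist⇒clockwise-≤ y≤x x<n (trans (cycleDist-comm n y x) dist≡d))

clockwise-colours-differ : ∀ {n k d} (κ : ℕ → Fin k) → (∀ x → κ (x + n) ≡ κ x) →
                           (∀ x → κ (x + d) ≢ κ x) → ∀ {x y} → Clockwise n d x y → κ y ≢ κ x
clockwise-colours-differ κ period jump {x} (inj₁ refl) = jump x
clockwise-colours-differ κ period jump {x} {y} (inj₂ y+n≡x+d) κy≡κx =
  jump x (trans (cong κ (sym y+n≡x+d)) (trans (period y) κy≡κx))

periodic⇒proper : ∀ {n k} (D : ℕ → Set) (κ : ℕ → Fin k) → (∀ x → κ (x + n) ≡ κ x) →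
                  (∀ {d} → D d → ∀ x → κ (x + d) ≢ κ x) → ProperColouring n D k (κ ∘ toℕ)
periodic⇒proper D κ period jump i j (_ , Dd) κi≡κj
  with cycleDist⇒clockwise (toℕ<n i) (toℕ<n j) refl
... | inj₁ i↻j = clockwise-colours-differ κ period (jump Dd) i↻j (sym κi≡κj)
... | inj₂ j↻i = clockwise-colours-differ κ period (jump Dd) j↻i κi≡κj

colourable-mono : ∀ {n D m m′} → m ≤ m′ → Colourable n D m → Colourable n D m′
colourable-mono m≤m′ (c , proper) =
  (λ i → inject≤ (c i) m≤m′) , λ i j adj → proper i j adj ∘ inject≤-injective _ _ _ _

%-≡⇒mod-≡ : ∀ a b d .{{_ : NonZero d}} → a % d ≡ b % d → a mod d ≡ b mod d
%-≡⇒mod-≡ a b d eq = toℕ-injective (begin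
  toℕ (a mod d)  ≡⟨ toℕ-fromℕ< (m%n<n a d) ⟩
  a % d          ≡⟨ eq ⟩
  b % d          ≡⟨ toℕ-fromℕ< (m%n<n b d) ⟨
  toℕ (b mod d)  ∎)
  where open ≡-Reasoning

mod-≡⇒%-≡ : ∀ a b d .{{_ : NonZero d}} → a mod d ≡ b mod d → a % d ≡ b % d
mod-≡⇒%-≡ a b d eq =
  trans (sym (toℕ-fromℕ< (m%n<n a d))) (trans (cong toℕ eq) (toℕ-fromℕ< (m%n<n b d)))

[m+n]%d≡m%d⇒d∣n : ∀ m n d .{{_ : NonZero d}} → (m + n) % d ≡ m % d → d ∣ n
[m+n]%d≡m%d⇒d∣n m n d eq = divides ((m + n) / d ∸ m / d) (begin
  n                                                    ≡⟨ m+n∸m≡n m n ⟨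
  m + n ∸ m                                            ≡⟨ cong₂ _∸_ (m≡m%n+[m/n]*n (m + n) d) (m≡m%n+[m/n]*n m d) ⟩
  (m + n) % d + (m + n) / d * d ∸ (m % d + m / d * d)  ≡⟨ cong (λ r → r + (m + n) / d * d ∸ (m % d + m / d * d)) eq ⟩
  m % d + (m + n) / d * d ∸ (m % d + m / d * d)        ≡⟨ [m+n]∸[m+o]≡n∸o (m % d) _ _ ⟩
  (m + n) / d * d ∸ m / d * d                          ≡⟨ *-distribʳ-∸ d ((m + n) / d) (m / d) ⟨
  ((m + n) / d ∸ m / d) * d                            ∎)
  where open ≡-Reasoning

clockwise-wrap : ∀ {n t r} .{{_ : NonZero n}} → r < n → t ≤ n → Clockwise n t r ((r + t) % n)
clockwise-wrap {n} {t} {r} r<n t≤n with r + t <? n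
... | yes r+t<n = inj₁ (m<n⇒m%n≡m r+t<n)
... | no r+t≮n = inj₂ (begin
  (r + t) % n + n          ≡⟨ cong (_+ n) (m≤n⇒[n∸m]%m≡n%m n≤r+t) ⟨
  (r + t ∸ n) % n + n      ≡⟨ cong (_+ n) (m<n⇒m%n≡m r+t∸n<n) ⟩
  r + t ∸ n + n            ≡⟨ m∸n+n≡m n≤r+t ⟩
  r + t                    ∎)
  where
  open ≡-Reasoning
  n≤r+t : n ≤ r + t
  n≤r+t = ≮⇒≥ r+t≮n
  r+t∸n<n : r + t ∸ n < n
  r+t∸n<n = subst (r + t ∸ n <_) (m+n∸n≡m n n) (∸-monoˡ-< (+-mono-<-≤ r<n t≤n) n≤r+t)

clockwise-% : ∀ {n t} .{{_ : NonZero n}} x → t < n → Clockwise n t (x % n) ((x + t) % n)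
clockwise-% {n} {t} x t<n =
  subst (Clockwise n t (x % n)) (sym [x+t]%n≡[x%n+t]%n) (clockwise-wrap (m%n<n x n) (<⇒≤ t<n))
  where
  [x+t]%n≡[x%n+t]%n : (x + t) % n ≡ (x % n + t) % n
  [x+t]%n≡[x%n+t]%n = trans (%-distribˡ-+ x t n) (cong (λ r → (x % n + r) % n) (m<n⇒m%n≡m t<n))

alternating-Fin2 : (g : ℕ → Fin 2) → (∀ k → g (suc k) ≢ g k) → ∀ i → g (2 * i) ≡ g 0
alternating-Fin2 g flips zero = refl
alternating-Fin2 g flips (suc i) = trans (cong g (*-suc 2 i))
  (trans (two-steps (g (2 + 2 * i)) (g (1 + 2 * i)) (g (2 * i)) (flips (1 + 2 * i)) (flips (2 * i)))
    (alternating-Fin2 g flips i))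
  where
  two-steps : (a b c : Fin 2) → a ≢ b → b ≢ c → a ≡ c
  two-steps Fin.zero Fin.zero _ a≢b _ = contradiction refl a≢b
  two-steps (Fin.suc Fin.zero) (Fin.suc Fin.zero) _ a≢b _ = contradiction refl a≢b
  two-steps _ Fin.zero Fin.zero _ b≢c = contradiction refl b≢c
  two-steps _ (Fin.suc Fin.zero) (Fin.suc Fin.zero) _ b≢c = contradiction refl b≢c
  two-steps Fin.zero (Fin.suc Fin.zero) Fin.zero _ _ = refl
  two-steps (Fin.suc Fin.zero) Fin.zero (Fin.suc Fin.zero) _ _ = refl

cdist-positive⇒distinct : ∀ {n} {i j : Fin n} → 0 < cdist n i j → i ≢ j
cdist-positive⇒distinct {n} {i} 0<d refl =
  n≮0 (subst (0 <_) (cong (λ δ → δ ⊓ (n ∸ δ)) (∣n-n∣≡0 (toℕ i))) 0<d)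

Odd : ℕ → Set
Odd n = ∃ λ j → n ≡ suc (2 * j)

odd-cycle-not-2-colourable : ∀ {n t} (D : ℕ → Set) → Odd n → 0 < t → t + t ≤ n → D t →
                             ¬ Colourable n D 2
odd-cycle-not-2-colourable {t = t} D (j , refl) 0<t t+t≤n Dt (c , proper) =
  flips (2 * j) (trans closes (sym (alternating-Fin2 g flips j)))
  where
  n = suc (2 * j)
  t<n : t < n
  t<n = <-≤-trans (m<m+n t 0<t) t+t≤n
  step : ∀ x → cdist n (x mod n) ((x + t) mod n) ≡ t
  step x = trans (cong₂ (cycleDist n) (toℕ-fromℕ< (m%n<n x n)) (toℕ-fromℕ< (m%n<n (x + t) n)))
                 (clockwise⇒cycleDist t+t≤n (clockwise-% x t<n))
  g : ℕ → Fin 2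
  g k = c ((k * t) mod n)
  flips : ∀ k → g (suc k) ≢ g k
  flips k gsk≡gk = proper (x mod n) ((x + t) mod n) (cdist-positive⇒distinct 0<dist , subst D (sym (step x)) Dt)
    (sym (trans (cong (λ y → c (y mod n)) (+-comm x t)) gsk≡gk))
    where
    x = k * t
    0<dist = subst (0 <_) (sym (step x)) 0<t
  closes : g n ≡ g 0
  closes = cong c (%-≡⇒mod-≡ (n * t) 0 n (trans (cong (_% n) (*-comm n t)) (m*n%n≡0 t n)))

odd-cycle-lower-bound : ∀ {n t} (D : ℕ → Set) → Odd n → 0 < t → t + t ≤ n → D t →
                        ∀ m → Colourable n D m → 3 ≤ m
odd-cycle-lower-bound D n-odd 0<t t+t≤n Dt m col with m ≤? 2
... | yes m≤2 = contradiction (colourable-mono {D = D} m≤2 col) (odd-cycle-not-2-colourable D n-odd 0<t t+t≤n Dt)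
... | no m≰2 = ≰⇒> m≰2

[m+kn]/n≡m/n+k : ∀ m k n .{{_ : NonZero n}} → (m + k * n) / n ≡ m / n + k
[m+kn]/n≡m/n+k m k n = trans (+-distrib-/-∣ʳ m (n∣m*n k)) (cong (m / n +_) (m*n/n≡m k n))

+-distrib-/-carry : ∀ m n d .{{_ : NonZero d}} → ∃ λ c → c ≤ 1 × (m + n) / d ≡ m / d + (n / d + c)
+-distrib-/-carry m n d = c , s≤s⁻¹ c<2 , (begin
  (m + n) / d                                      ≡⟨ cong (_/ d) split ⟩
  (m % d + n % d + (m / d + n / d) * d) / d        ≡⟨ [m+kn]/n≡m/n+k (m % d + n % d) (m / d + n / d) d ⟩
  c + (m / d + n / d)                              ≡⟨ rotate c (m / d) (n / d) ⟩
  m / d + (n / d + c)                              ∎)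
  where
  open ≡-Reasoning
  c = (m % d + n % d) / d
  c<2 : c < 2
  c<2 = m<n*o⇒m/o<n (subst (m % d + n % d <_) (cong (d +_) (sym (+-identityʳ d)))
                       (+-mono-< (m%n<n m d) (m%n<n n d)))
  regroup : ∀ r q r′ q′ d → r + q * d + (r′ + q′ * d) ≡ r + r′ + (q + q′) * d
  regroup = solve-∀
  split : m + n ≡ m % d + n % d + (m / d + n / d) * d
  split = trans (cong₂ _+_ (m≡m%n+[m/n]*n m d) (m≡m%n+[m/n]*n n d)) (regroup (m % d) (m / d) (n % d) (n / d) d)
  rotate : ∀ c a b → c + (a + b) ≡ a + (b + c)
  rotate = solve-∀

¬3∣t⇒∃e[e*t+q]%3≡1 : ∀ t q → ¬ 3 ∣ t → ∃ λ e → (e * t + q) % 3 ≡ 1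
¬3∣t⇒∃e[e*t+q]%3≡1 t q 3∤t with solve-mod-3 (t % 3) (q % 3) 0<t%3 (m%n<n t 3) (m%n<n q 3)
  where
  0<t%3 : 0 < t % 3
  0<t%3 = n≢0⇒n>0 (3∤t ∘ m%n≡0⇒n∣m t 3)
  solve-mod-3 : ∀ r r′ → 0 < r → r < 3 → r′ < 3 → ∃ λ e → (e * r + r′) % 3 ≡ 1
  solve-mod-3 1 0 _ _ _ = 1 , refl
  solve-mod-3 1 1 _ _ _ = 0 , refl
  solve-mod-3 1 2 _ _ _ = 2 , refl
  solve-mod-3 2 0 _ _ _ = 2 , refl
  solve-mod-3 2 1 _ _ _ = 0 , refl
  solve-mod-3 2 2 _ _ _ = 1 , refl
  solve-mod-3 (suc (suc (suc _))) _ _ (s≤s (s≤s (s≤s ()))) _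
  solve-mod-3 (suc _) (suc (suc (suc _))) _ _ (s≤s (s≤s (s≤s ())))
... | e , [er+r′]%3≡1 = e , (begin
  (e * t + q) % 3                                   ≡⟨ cong (_% 3) split ⟩
  (e * (t % 3) + q % 3 + (e * (t / 3) + q / 3) * 3) % 3 ≡⟨ [m+kn]%n≡m%n (e * (t % 3) + q % 3) (e * (t / 3) + q / 3) 3 ⟩
  (e * (t % 3) + q % 3) % 3                         ≡⟨ [er+r′]%3≡1 ⟩
  1                                                 ∎)
  where
  open ≡-Reasoning
  regroup : ∀ e r x r′ y → e * (r + x * 3) + (r′ + y * 3) ≡ e * r + r′ + (e * x + y) * 3
  regroup = solve-∀
  split : e * t + q ≡ e * (t % 3) + q % 3 + (e * (t / 3) + q / 3) * 3
  split = trans (cong₂ (λ a b → e * a + b) (m≡m%n+[m/n]*n t 3) (m≡m%n+[m/n]*n q 3))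
                (regroup e (t % 3) (t / 3) (q % 3) (q / 3))

m%3≡1∧c≤1⇒3∤m+c : ∀ m c → m % 3 ≡ 1 → c ≤ 1 → ¬ 3 ∣ m + c
m%3≡1∧c≤1⇒3∤m+c m c m%3≡1 c≤1 3∣m+c = small c c≤1 (begin
  (1 + c % 3) % 3        ≡⟨ cong (λ r → (r + c % 3) % 3) m%3≡1 ⟨
  (m % 3 + c % 3) % 3    ≡⟨ %-distribˡ-+ m c 3 ⟨
  (m + c) % 3            ≡⟨ n∣m⇒m%n≡0 (m + c) 3 3∣m+c ⟩
  0                      ∎)
  where
  open ≡-Reasoning
  small : ∀ c → c ≤ 1 → (1 + c % 3) % 3 ≢ 0
  small zero z≤n ()
  small (suc zero) (s≤s z≤n) ()

module DigitColouring (B : ℕ) .{{_ : NonZero B}} (e : ℕ) where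

  level : ℕ → ℕ
  level x = e * x + x / B

  colour : ℕ → Fin 3
  colour x = level x mod 3

  level-+ : ∀ x y {w} → (x + y) / B ≡ x / B + w → level (x + y) ≡ level x + (e * y + w)
  level-+ x y {w} [x+y]/B≡ = trans (cong (e * (x + y) +_) [x+y]/B≡) (regroup e x y (x / B) w)
    where
    regroup : ∀ e x y a w → e * (x + y) + (a + w) ≡ e * x + a + (e * y + w)
    regroup = solve-∀

  colour-+-≡ : ∀ x y {w} → (x + y) / B ≡ x / B + w → 3 ∣ e * y + w → colour (x + y) ≡ colour x
  colour-+-≡ x y [x+y]/B≡ 3∣ =
    %-≡⇒mod-≡ (level (x + y)) (level x) 3 (trans (cong (_% 3) (level-+ x y [x+y]/B≡)) (%-remove-+ʳ (level x) 3∣))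

  colour-+-≢ : ∀ x y {w} → (x + y) / B ≡ x / B + w → ¬ 3 ∣ e * y + w → colour (x + y) ≢ colour x
  colour-+-≢ x y [x+y]/B≡ 3∤ same = 3∤ ([m+n]%d≡m%d⇒d∣n (level x) _ 3
    (trans (cong (_% 3) (sym (level-+ x y [x+y]/B≡))) (mod-≡⇒%-≡ (level (x + y)) (level x) 3 same)))

three-colouring : ∀ {n s t B s′} .{{_ : NonZero B}} → 3 ∣ B → 3 * B ∣ n → s ≡ s′ * B → ¬ 3 ∣ s′ → ¬ 3 ∣ t →
                  Colourable n (Pair s t) 3
three-colouring {t = t} {B} {s′} 3∣B (divides K refl) refl 3∤s′ 3∤t with ¬3∣t⇒∃e[e*t+q]%3≡1 t (t / B) 3∤t
... | e , [et+t/B]%3≡1 = colour ∘ toℕ , periodic⇒proper (Pair (s′ * B) t) colour period jump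
  where
  open DigitColouring B e
  period : ∀ x → colour (x + K * (3 * B)) ≡ colour x
  period x rewrite sym (*-assoc K 3 B) = colour-+-≡ x (K * 3 * B) ([m+kn]/n≡m/n+k x (K * 3) B)
    (∣m∣n⇒∣m+n (∣n⇒∣m*n e (∣m⇒∣m*n B (n∣m*n K))) (n∣m*n K))
  jump : ∀ {d} → Pair (s′ * B) t d → ∀ x → colour (x + d) ≢ colour x
  jump (inj₁ refl) x = colour-+-≢ x (s′ * B) ([m+kn]/n≡m/n+k x s′ B)
    (3∤s′ ∘ λ 3∣ → ∣m+n∣m⇒∣n 3∣ (∣n⇒∣m*n e (∣n⇒∣m*n s′ 3∣B)))
  jump (inj₂ refl) x with +-distrib-/-carry x t B
  ... | c , c≤1 , [x+t]/B≡ = colour-+-≢ x t [x+t]/B≡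
    (subst (¬_ ∘ (3 ∣_)) (+-assoc (e * t) (t / B) c) (m%3≡1∧c≤1⇒3∤m+c (e * t + t / B) c [et+t/B]%3≡1 c≤1))

factor-out : ∀ p → 1 < p → ∀ s → 0 < s → ∃₂ λ a s′ → s ≡ s′ * p ^ a × ¬ p ∣ s′
factor-out p 1<p = <-rec Factorisation go
  where
  Factorisation : ℕ → Set
  Factorisation s = 0 < s → ∃₂ λ a s′ → s ≡ s′ * p ^ a × ¬ p ∣ s′
  go : ∀ s → (∀ {q} → q < s → Factorisation q) → Factorisation s
  go s rec 0<s with p ∣? s
  ... | no p∤s = 0 , s , sym (*-identityʳ s) , p∤s
  ... | yes (divides q refl) with rec (m<m*n q p {{>-nonZero 0<q}} 1<p) 0<q
    where
    0<q : 0 < q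
    0<q = n≢0⇒n>0 λ q≡0 → n≮0 (subst (λ q → 0 < q * p) q≡0 0<s)
  ...   | a , s′ , q≡s′*p^a , p∤s′ = suc a , s′ , (begin
    q * p                ≡⟨ cong (_* p) q≡s′*p^a ⟩
    s′ * p ^ a * p       ≡⟨ *-assoc s′ (p ^ a) p ⟩
    s′ * (p ^ a * p)     ≡⟨ cong (s′ *_) (*-comm (p ^ a) p) ⟩
    s′ * p ^ suc a       ∎) , p∤s′
    where open ≡-Reasoning

^-monoʳ-∣ : ∀ p {a b} → a ≤ b → p ^ a ∣ p ^ b
^-monoʳ-∣ p {a} a≤b with m≤n⇒∃[o]m+o≡n a≤b
... | k , refl = divides (p ^ k) (trans (^-distribˡ-+-* p a k) (*-comm (p ^ a) (p ^ k)))

3^n-odd : ∀ n → Odd (3 ^ n)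
3^n-odd zero = 0 , refl
3^n-odd (suc n) with 3^n-odd n
... | j , 3^n≡1+2j = 1 + 3 * j , trans (cong (3 *_) 3^n≡1+2j) (triple j)
  where
  triple : ∀ j → 3 * suc (2 * j) ≡ suc (2 * (1 + 3 * j))
  triple = solve-∀

lemma3p3p4 : (u s t : ℕ) → 2 ≤ u → 1 ≤ s → 2 * s ≤ 3 ^ u → 1 ≤ t → 2 * t ≤ 3 ^ u →
    3 ∣ s → ¬ (3 ∣ t) → ChromaticNumberIs (3 ^ u) (Pair s t) 3
lemma3p3p4 u s t _ 1≤s 2s≤n 1≤t 2t≤n 3∣s 3∤t with factor-out 3 (s≤s (s≤s z≤n)) s 1≤s
... | zero , s′ , s≡s′*1 , 3∤s′ =
  contradiction (subst (3 ∣_) (trans s≡s′*1 (*-identityʳ s′)) 3∣s) 3∤s′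
... | suc a , s′ , s≡s′*B , 3∤s′ =
  three-colouring {{m^n≢0 3 (suc a)}} (m∣m*n (3 ^ a)) (^-monoʳ-∣ 3 a+1<u) s≡s′*B 3∤s′ 3∤t ,
  odd-cycle-lower-bound (Pair s t) (3^n-odd u) 1≤t (2*m≤n⇒m+m≤n t 2t≤n) (inj₂ refl)
  where
  2*m≤n⇒m+m≤n : ∀ m {n} → 2 * m ≤ n → m + m ≤ n
  2*m≤n⇒m+m≤n m {n} = subst (_≤ n) (cong (m +_) (+-identityʳ m))
  B≤s : 3 ^ suc a ≤ s
  B≤s = ∣⇒≤ {{>-nonZero 1≤s}} (divides s′ s≡s′*B)
  s<n : s < 3 ^ u
  s<n = <-≤-trans (m<m+n s 1≤s) (2*m≤n⇒m+m≤n s 2s≤n)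
  a+1<u : suc a < u
  a+1<u = ≰⇒> λ u≤a+1 → <⇒≱ (≤-<-trans B≤s s<n) (^-monoʳ-≤ 3 u≤a+1)
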